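{- Let $d\geq 2$ and let $S=S_{d-1}$ and $\Phi$ be as described below. If $S$ (equivalently, the subcomplex $\Gamma\cong S$ of $\Phi$) has no induced centrally symmetric $4$-cycle, then $\Phi$ has no induced centrally symmetric $4$-cycle.
   Context: A simplicial complex is centrally symmetric (cs) if its vertex set carries a free involution $\sigma$ mapping faces to faces and inducing a free involution on non-empty faces. An induced cs $4$-cycle is an induced subcomplex $C$ isomorphic to a $4$-cycle with $\sigma(C)=C$. Contracting an edge $\{i,j\}$ means taking the image under the simplicial map identifying $i$ with $j$. $\mathrm{st}_\Delta(F)=\{G\in\Delta:G\cup F\in\Delta\}$; $\Delta\setminus\Gamma$ is the induced subcomplex on $V(\Delta)\setminus V(\Gamma)$; $x*K$ is a cone with apex $x$. Property $\mathrm{P}_k$ ($k\geq1$): a cs PL $k$-sphere $S$ with involution $\sigma$ satisfies $\mathrm{P}_k$ if there are subcomplexes $S_0\subset\cdots\subset S_k=S$, each a PL $i$-sphere invariant under $\sigma$, and for $1\leq i\leq k$ PL $i$-balls $B_i,D_i\subseteq S_i$ and a vertex $v_i\in D_i$ with: (i) $S_i=B_i\cup\sigma(B_i)$, $B_i\cap\sigma(B_i)=\partial B_i=S_{i-1}$; (ii) $S_i\setminus S_{i-1}$ is the union of $D_i$ and $\sigma(D_i)$ on disjoint vertex sets; (iii) $V(\mathrm{st}_{S_i}(v_i))\cup V(\mathrm{st}_{S_i}(\sigma(v_i)))=V(S_i)$; $v_0$ is a vertex of $S_0$. Let $S$ be a cs PL $(d-1)$-sphere satisfying $\mathrm{P}_{d-1}$,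 $B=B_{d-1}$, $D=D_{d-1}$, $W=V(D)\cup V(\mathrm{st}_{S_{d-2}}(v_{d-2}))$ (so $V(S)=W\uplus\sigma(W)$). Let $\ell$ be a locally acyclic orientation of $S$ (no $2$-simplex contains an oriented cycle) with $u\to w$ for every edge $\{u,w\}$, $u\in W$, $w\in\sigma(W)$, and $u\to w$ iff $\sigma(w)\to\sigma(u)$. Let $\Sigma$ be the complex on $V(S)\times\{ -1,1\}$ with edges $\{(u,1),(u,-1)\}$, $\{(u,t),(w,t)\}$ ($t=\pm1$, $\{u,w\}\in S$), $\{(u,1),(w,-1)\}$ for $u\to w$, whose faces are the vertex sets projecting to a face of $S$ with every pair an edge; involution $(u,t)\mapsto(\sigma(u),-t)$. With new vertices $v_\pm,w_\pm$ let $K_+=B\times\{1\}$, $K_-=\sigma(B)\times\{ -1\}$, $L_+=(\sigma(B)\times\{1\})\cup(v_+*(\partial B\times\{1\}))$, $L_-=(B\times\{ -1\})\cup(v_-*(\partial B\times\{ -1\}))$, $\Phi'=\Sigma\cup(v_+*K_+)\cup(v_-*K_-)\cup(w_+*L_+)\cup(w_-*L_-)$ (involution $v_+\leftrightarrow v_-$, $w_+\leftrightarrow w_-$), and let $\Phi$ be obtained from $\Phi'$ by contracting every edge $\{(u,1),(u,-1)\}$ with $u\in V(D)\cup V(\sigma(D))$. $\Gamma\subseteq\Phi$ denotes the image of $S$ under $u\mapsto(u,1)$ for $u\in W$, $u\mapsto(u,-1)$ for $u\in\sigma(W)$; it is isomorphic to $S$. -}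

module Defs where

open import Data.Nat using (ℕ; zero; suc; _≤_; _<_; _∸_)
open import Data.Bool using (Bool; true; false; not)
open import Data.List using (List; []; _∷_; map; length; _++_; upTo)
open import Data.List.Membership.Propositional using (_∈_)
open import Data.List.Relation.Binary.Subset.Propositional using (_⊆_)
open import Data.List.Relation.Unary.All using (All)
open import Data.List.Relation.Unary.Unique.Propositional using (Unique)
open import Data.List.Relation.Binary.Pointwise using (Pointwise)
open import Data.Product using (_×_; Σ; ∃; ∃-syntax; _,_; proj₁)
open import Data.Sum using (_⊎_; inj₁; inj₂)
open import Relation.Nullary using (¬_)
open import Relation.Binary.PropositionalEquality using (_≡_; _≢_)

-- A complex on a vertex type V is a predicate on finite vertex sets,
-- where a finite set is presented by a list (order / repetitions are
-- irrelevant since complexes are required to be closed under ⊆ of lists).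

Complex : Set → Set₁
Complex V = List V → Set

_∼_ : {V : Set} → List V → List V → Set
F ∼ G = (F ⊆ G) × (G ⊆ F)

record IsComplex {V : Set} (Δ : Complex V) : Set where
  field
    empty    : Δ []
    downward : ∀ F G → G ⊆ F → Δ F → Δ G
    finite   : ∃[ vs ] (∀ F → Δ F → F ⊆ vs)

_≐_ : {V : Set} → Complex V → Complex V → Set
Δ ≐ Γ = ∀ F → (Δ F → Γ F) × (Γ F → Δ F)

infixr 5 _∪ᶜ_
_∪ᶜ_ : {V : Set} → Complex V → Complex V → Complex V
(Δ ∪ᶜ Γ) F = Δ F ⊎ Γ F

_∩ᶜ_ : {V : Set} → Complex V → Complex V → Complex V
(Δ ∩ᶜ Γ) F = Δ F × Γ F

SubC : {V : Set} → Complex V → Complex V → Set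
SubC Γ Δ = ∀ F → Γ F → Δ F

IsVertex : {V : Set} → Complex V → V → Set
IsVertex Δ v = Δ (v ∷ [])

Ind : {V : Set} → Complex V → (V → Set) → Complex V
Ind Δ P F = Δ F × All P F

_∖ᶜ_ : {V : Set} → Complex V → Complex V → Complex V
Δ ∖ᶜ Γ = Ind Δ (λ v → ¬ IsVertex Γ v)

Img : {V W : Set} → (V → W) → Complex V → Complex W
Img f Δ G = ∃[ F ] (Δ F × G ∼ map f F)

Cone : {V : Set} → V → Complex V → Complex V
Cone a K G = K G ⊎ ∃[ H ] (K H × G ∼ (a ∷ H))

InvariantUnder : {V : Set} → (V → V) → Complex V → Set
InvariantUnder σ Δ = ∀ F → Δ F → Δ (map σ F)

record IsCS {V : Set} (Δ : Complex V) (σ : V → V) : Set where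
  field
    invol     : ∀ u → IsVertex Δ u → σ (σ u) ≡ u
    freeVert  : ∀ u → IsVertex Δ u → σ u ≢ u
    faces     : InvariantUnder σ Δ
    freeFaces : ∀ F → Δ F → F ≢ [] → ¬ (map σ F ∼ F)

-- Δ has an induced centrally symmetric 4-cycle, where the involution on
-- vertices is given as a (functional) relation Inv.
HasInducedCS4 : {V : Set} → Complex V → (V → V → Set) → Set
HasInducedCS4 {V} Δ Inv =
  Σ V λ a → Σ V λ b → Σ V λ c → Σ V λ e →
    (a ≢ b) × (a ≢ c) × (a ≢ e) × (b ≢ c) × (b ≢ e) × (c ≢ e) ×
    (∀ G → G ⊆ (a ∷ b ∷ c ∷ e ∷ []) →
       (Δ G → Cyc a b c e G) × (Cyc a b c e G → Δ G)) ×
    (∀ x y → x ∈ (a ∷ b ∷ c ∷ e ∷ []) → Inv x y → y ∈ (a ∷ b ∷ c ∷ e ∷ []))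
  where
  Cyc : V → V → V → V → List V → Set
  Cyc a b c e G = (G ⊆ (a ∷ b ∷ [])) ⊎ (G ⊆ (b ∷ c ∷ [])) ⊎
                  (G ⊆ (c ∷ e ∷ [])) ⊎ (G ⊆ (e ∷ a ∷ []))

-- PL spheres and balls, via stellar moves (Alexander–Newman):
-- complexes are PL homeomorphic iff related by a finite sequence of
-- stellar subdivisions, their inverses (welds) and isomorphisms.

-- stellar subdivision of Δ at the face F with new vertex x:
-- (Δ minus open star of F) ∪ x * ∂F * lk F
Stellar : Complex ℕ → List ℕ → ℕ → Complex ℕ
Stellar Δ F x G =
  (Δ G × ¬ (F ⊆ G)) ⊎ ∃[ G' ] (Δ (G' ++ F) × ¬ (F ⊆ G') × G ∼ (x ∷ G'))

data StStep : Complex ℕ → Complex ℕ → Set₁ where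
  subdiv : ∀ {Δ Δ'} (F : List ℕ) (x : ℕ) → Δ F → F ≢ [] →
           ¬ IsVertex Δ x → Δ' ≐ Stellar Δ F x → StStep Δ Δ'
  rename : ∀ {Δ Δ'} (f : ℕ → ℕ) →
           (∀ u w → IsVertex Δ u → IsVertex Δ w → f u ≡ f w → u ≡ w) →
           Δ' ≐ Img f Δ → StStep Δ Δ'

data StEq : Complex ℕ → Complex ℕ → Set₁ where
  done : ∀ {Δ} → StEq Δ Δ
  fwd  : ∀ {Δ Δ' Δ''} → StStep Δ Δ' → StEq Δ' Δ'' → StEq Δ Δ''
  bwd  : ∀ {Δ Δ' Δ''} → StStep Δ' Δ → StEq Δ' Δ'' → StEq Δ Δ''

Simplex : ℕ → Complex ℕ
Simplex n G = G ⊆ upTo (suc n)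

-- boundary of the (n+1)-simplex on {0,…,n+1}
BdSimplex : ℕ → Complex ℕ
BdSimplex n G = (G ⊆ upTo (suc (suc n))) × ¬ (upTo (suc (suc n)) ⊆ G)

PLSphere : ℕ → Complex ℕ → Set₁
PLSphere n Δ = IsComplex Δ × StEq Δ (BdSimplex n)

PLBall : ℕ → Complex ℕ → Set₁
PLBall n Δ = IsComplex Δ × StEq Δ (Simplex n)

-- boundary of an n-dimensional pure complex (e.g. a PL n-ball):
-- faces contained in an (n-1)-face that lies in exactly one n-face
Bd : ℕ → Complex ℕ → Complex ℕ
Bd n Δ F =
  ∃[ G ] (Δ G × Unique G × length G ≡ n × F ⊆ G ×
    ∃[ H ] (Δ H × Unique H × length H ≡ suc n × G ⊆ H ×
      (∀ H' → Δ H' → Unique H' → length H' ≡ suc n → G ⊆ H' → H' ⊆ H)))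

record PLevel (i : ℕ) (σ : ℕ → ℕ) (Si Sprev B D : Complex ℕ) (v : ℕ) : Set₁ where
  field
    ballB   : PLBall i B
    ballD   : PLBall i D
    subB    : SubC B Si
    subD    : SubC D Si
    vInD    : IsVertex D v
    unionB  : Si ≐ (B ∪ᶜ Img σ B)
    interB  : (B ∩ᶜ Img σ B) ≐ Bd i B
    bdB     : Bd i B ≐ Sprev
    diffD   : (Si ∖ᶜ Sprev) ≐ (D ∪ᶜ Img σ D)
    disjD   : ∀ u → IsVertex D u → ¬ IsVertex (Img σ D) u
    stars   : ∀ w → IsVertex Si w → Si (w ∷ v ∷ []) ⊎ Si (w ∷ σ v ∷ [])

record PropP (k : ℕ) (S : Complex ℕ) (σ : ℕ → ℕ)
             (Sf Bf Df : ℕ → Complex ℕ) (vf : ℕ → ℕ) : Set₁ where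
  field
    top    : Sf k ≐ S
    sphere : ∀ i → i ≤ k → PLSphere i (Sf i)
    subS   : ∀ i → i ≤ k → SubC (Sf i) S
    invS   : ∀ i → i ≤ k → InvariantUnder σ (Sf i)
    chain  : ∀ i → i < k → SubC (Sf i) (Sf (suc i))
    v0     : IsVertex (Sf 0) (vf 0)
    level  : ∀ j → suc j ≤ k →
             PLevel (suc j) σ (Sf (suc j)) (Sf j) (Bf (suc j)) (Df (suc j)) (vf (suc j))

record IsLocAcyclicOrientation (S : Complex ℕ) (Or : ℕ → ℕ → Set) : Set where
  field
    onEdges : ∀ u w → Or u w → S (u ∷ w ∷ []) × u ≢ w
    total   : ∀ u w → u ≢ w → S (u ∷ w ∷ []) → Or u w ⊎ Or w u
    antisym : ∀ u w → Or u w → ¬ Or w u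
    acyclic : ∀ a b c → S (a ∷ b ∷ c ∷ []) → Or a b → Or b c → ¬ Or c a

-- The construction of Φ.  Sign +1 is `true`, -1 is `false`.

data Apex : Set where
  vp vm wp wm : Apex

PV : Set
PV = (ℕ × Bool) ⊎ Apex

lift : Bool → ℕ → PV
lift t u = inj₁ (u , t)

SigE0 : Complex ℕ → (ℕ → ℕ → Set) → ℕ × Bool → ℕ × Bool → Set
SigE0 S Or (u , t) (w , t') =
  (u ≡ w × t ≢ t') ⊎ (t ≡ t' × u ≢ w × S (u ∷ w ∷ [])) ⊎
  (t ≡ true × t' ≡ false × Or u w)

SigE : Complex ℕ → (ℕ → ℕ → Set) → ℕ × Bool → ℕ × Bool → Set
SigE S Or p q = SigE0 S Or p q ⊎ SigE0 S Or q p

Sigma : Complex ℕ → (ℕ → ℕ → Set) → Complex (ℕ × Bool)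
Sigma S Or G =
  S (map proj₁ G) × (∀ p q → p ∈ G → q ∈ G → p ≡ q ⊎ SigE S Or p q)

-- Φ' ; d is the dimension parameter, B is the (d-1)-ball
Phi' : ℕ → Complex ℕ → (ℕ → ℕ) → Complex ℕ → (ℕ → ℕ → Set) → Complex PV
Phi' d S σ B Or =
  Img inj₁ (Sigma S Or) ∪ᶜ Cone (inj₂ vp) Kp ∪ᶜ Cone (inj₂ vm) Km ∪ᶜ
  Cone (inj₂ wp) Lp ∪ᶜ Cone (inj₂ wm) Lm
  where
  Kp Km Lp Lm : Complex PV
  Kp = Img (lift true) B
  Km = Img (lift false) (Img σ B)
  Lp = Img (lift true) (Img σ B) ∪ᶜ Cone (inj₂ vp) (Img (lift true) (Bd (d ∸ 1) B))
  Lm = Img (lift false) B ∪ᶜ Cone (inj₂ vm) (Img (lift false) (Bd (d ∸ 1) B))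

CRel : (ℕ → Set) → PV → PV → Set
CRel DD (inj₁ (u , false)) y =
  (DD u × y ≡ inj₁ (u , true)) ⊎ (¬ DD u × y ≡ inj₁ (u , false))
CRel DD (inj₁ (u , true)) y = y ≡ inj₁ (u , true)
CRel DD (inj₂ a) y = y ≡ inj₂ a

DDset : (ℕ → ℕ) → Complex ℕ → ℕ → Set
DDset σ D u = IsVertex D u ⊎ IsVertex (Img σ D) u

Phi : ℕ → Complex ℕ → (ℕ → ℕ) → Complex ℕ → Complex ℕ → (ℕ → ℕ → Set) → Complex PV
Phi d S σ B D Or G =
  ∃[ F ] (Phi' d S σ B Or F ×
    ∃[ G' ] (Pointwise (CRel (DDset σ D)) F G' × G ∼ G'))

ιΦ : (ℕ → ℕ) → PV → PV
ιΦ σ (inj₁ (u , t)) = inj₁ (σ u , not t)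
ιΦ σ (inj₂ vp) = inj₂ vm
ιΦ σ (inj₂ vm) = inj₂ vp
ιΦ σ (inj₂ wp) = inj₂ wm
ιΦ σ (inj₂ wm) = inj₂ wp

InvPhi : (ℕ → ℕ) → Complex ℕ → PV → PV → Set
InvPhi σ D x y = ∃[ z ] (CRel (DDset σ D) z x × CRel (DDset σ D) (ιΦ σ z) y)

InW : Complex ℕ → Complex ℕ → ℕ → ℕ → Set
InW D Sdm2 vdm2 u = IsVertex D u ⊎ Sdm2 (u ∷ vdm2 ∷ [])

{-# OPTIONS --safe #-}
module Submission where

-- An apex p of Φ and its antipode have opposite signs, whereas apexes sharing a face have
-- equal signs; and a vertex (u , t) adjacent to both p and its antipode would have the two
-- preimages (u , 1) and (u , -1), hence u ∈ V(D) ∪ V(σ D), while lying over B ∩ σ(B) = ∂B,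
-- which is disjoint from D.  So an induced cs 4-cycle of Φ has no apex, and it lies over a
-- closed 4-walk u w x y of S whose vertex set is σ-invariant.  As S has no edge {v , σ v},
-- x = σ u and y = σ w, and then u w (σ u) (σ w) is an induced cs 4-cycle of S.

open import Defs
open import Data.Nat using (ℕ; _≤_; _∸_; suc; s≤s; z≤n; _≟_)
open import Data.Nat.Properties using (≤-refl)
open import Data.Bool using (Bool; true; false)
open import Data.Product using (∃-syntax; _×_; _,_; proj₁; proj₂)
open import Data.Sum using (_⊎_; inj₁; inj₂)
open import Data.Sum.Properties using (inj₂-injective)
open import Data.Empty using (⊥; ⊥-elim)
open import Data.List using (List; []; _∷_; map)
open import Data.List.Membership.Propositional using (_∈_; _∉_)
open import Data.List.Membership.Propositional.Properties using (∈-map⁻; ∈-map⁺)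
open import Data.List.Relation.Unary.Any using (here; there)
open import Data.List.Relation.Unary.All using (_∷_)
open import Data.List.Relation.Binary.Subset.Propositional using (_⊆_)
open import Data.List.Relation.Binary.Subset.Propositional.Properties
  using (⊆-refl; ⊆-trans; ∈-∷⁺ʳ; ⊆∷∧∉⇒⊆)
open import Data.List.Relation.Binary.Pointwise using (Pointwise; _∷_)
open import Relation.Nullary using (¬_; yes; no)
open import Relation.Binary.Definitions using (DecidableEquality)
open import Relation.Binary.PropositionalEquality using (_≡_; _≢_; refl; sym; trans; cong; subst)

module _ {A : Set} where

  pair⊆ : ∀ {x y : A} {zs} → x ∈ zs → y ∈ zs → (x ∷ y ∷ []) ⊆ zs
  pair⊆ x∈ y∈ = ∈-∷⁺ʳ x∈ (∈-∷⁺ʳ y∈ (λ ()))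

  swap⊆ : ∀ {x y : A} → (x ∷ y ∷ []) ⊆ (y ∷ x ∷ [])
  swap⊆ = pair⊆ (there (here refl)) (here refl)

  rotate⊆ : ∀ {a b c e : A} → (a ∷ b ∷ c ∷ e ∷ []) ⊆ (b ∷ c ∷ e ∷ a ∷ [])
  rotate⊆ (here refl)                         = there (there (there (here refl)))
  rotate⊆ (there (here refl))                 = here refl
  rotate⊆ (there (there (here refl)))         = there (here refl)
  rotate⊆ (there (there (there (here refl)))) = there (there (here refl))
  rotate⊆ (there (there (there (there ()))))

  rotate²⊆ : ∀ {a b c e : A} → (a ∷ b ∷ c ∷ e ∷ []) ⊆ (c ∷ e ∷ a ∷ b ∷ [])
  rotate²⊆ = ⊆-trans rotate⊆ rotate⊆

  rotate³⊆ : ∀ {a b c e : A} → (a ∷ b ∷ c ∷ e ∷ []) ⊆ (e ∷ a ∷ b ∷ c ∷ [])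
  rotate³⊆ = ⊆-trans rotate²⊆ rotate⊆

  Pointwise-∈ʳ : ∀ {B : Set} {R : A → B → Set} {xs ys y} →
                 Pointwise R xs ys → y ∈ ys → ∃[ x ] (x ∈ xs × R x y)
  Pointwise-∈ʳ (r ∷ _)  (here refl) = _ , here refl , r
  Pointwise-∈ʳ (_ ∷ rs) (there y∈)  = let x , x∈ , r = Pointwise-∈ʳ rs y∈ in x , there x∈ , r

Occurs : {V : Set} → Complex V → V → Set
Occurs Δ v = ∃[ F ] (Δ F × v ∈ F)

Bd-downward : ∀ {n Δ F G} → G ⊆ F → Bd n Δ F → Bd n Δ G
Bd-downward G⊆F (H , ΔH , uH , ∣H∣ , F⊆H , facet) = H , ΔH , uH , ∣H∣ , ⊆-trans G⊆F F⊆H , facet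

module _ {V : Set} {Δ : Complex V} (isC : IsComplex Δ) where
  open IsComplex isC using (downward)

  face-edge : ∀ {F x y} → Δ F → x ∈ F → y ∈ F → Δ (x ∷ y ∷ [])
  face-edge ΔF x∈ y∈ = downward _ _ (pair⊆ x∈ y∈) ΔF

  occurs⇒vertex : ∀ {v} → Occurs Δ v → IsVertex Δ v
  occurs⇒vertex (_ , ΔF , v∈) = downward _ _ (∈-∷⁺ʳ v∈ (λ ())) ΔF

  edge-vertex : ∀ {u w} → Δ (u ∷ w ∷ []) → IsVertex Δ u
  edge-vertex uw = occurs⇒vertex (_ , uw , here refl)

  module _ {σ : V → V} (cs : IsCS Δ σ) where
    open IsCS cs using (invol; freeVert; freeFaces)

    no-antipodal-edge : ∀ {v} → ¬ Δ (v ∷ σ v ∷ [])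
    no-antipodal-edge {v} e =
      freeFaces _ e (λ ()) ( pair⊆ (there (here refl)) (here σσv≡v)
                           , pair⊆ (there (here (sym σσv≡v))) (here refl))
      where
      σσv≡v : σ (σ v) ≡ v
      σσv≡v = invol v (edge-vertex e)

    antipodes-not-in-face : ∀ {F v} → Δ F → v ∈ F → σ v ∉ F
    antipodes-not-in-face ΔF v∈ σv∈ = no-antipodal-edge (face-edge ΔF v∈ σv∈)

    antipode-opposite : ∀ {u w x y} → Δ (u ∷ w ∷ []) → Δ (y ∷ u ∷ []) →
                        σ u ∈ (u ∷ w ∷ x ∷ y ∷ []) → σ u ≡ x
    antipode-opposite uw _  (here σu≡u) = ⊥-elim (freeVert _ (edge-vertex uw) σu≡u)
    antipode-opposite uw _  (there (here refl)) =
      ⊥-elim (antipodes-not-in-face uw (here refl) (there (here refl)))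
    antipode-opposite _  _  (there (there (here σu≡x))) = σu≡x
    antipode-opposite _  yu (there (there (there (here refl)))) =
      ⊥-elim (antipodes-not-in-face yu (there (here refl)) (here refl))
    antipode-opposite _  _  (there (there (there (there ()))))

    module _ (_≟ᵥ_ : DecidableEquality V) where
      open import Data.List.Membership.DecPropositional _≟ᵥ_ using (_∈?_)

      antipode-absent : ∀ {G} v → Δ G → v ∉ G ⊎ σ v ∉ G
      antipode-absent {G} v ΔG with v ∈? G
      ... | no v∉  = inj₁ v∉
      ... | yes v∈ = inj₂ (antipodes-not-in-face ΔG v∈)

      -- A face on {u, w, σ u, σ w} misses one vertex of each antipodal pair, so it lies
      -- in one of the four edges.
      antipodal-square⇒HasInducedCS4 :
        ∀ {u w} → Δ (u ∷ w ∷ []) → Δ (w ∷ σ u ∷ []) → Δ (σ u ∷ σ w ∷ []) → Δ (σ w ∷ u ∷ []) →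
        HasInducedCS4 Δ (λ x y → y ≡ σ x)
      antipodal-square⇒HasInducedCS4 {u} {w} uw wσu σuσw σwu =
        u , w , σ u , σ w ,
        (λ { refl → no-antipodal-edge wσu }) ,
        (λ u≡σu → freeVert u (edge-vertex uw) (sym u≡σu)) ,
        (λ u≡σw → antipodes-not-in-face uw (there (here refl)) (here (sym u≡σw))) ,
        (λ w≡σu → antipodes-not-in-face uw (here refl) (there (here (sym w≡σu)))) ,
        (λ w≡σw → freeVert w (edge-vertex wσu) (sym w≡σw)) ,
        (λ σu≡σw → antipodes-not-in-face wσu (here refl) (there (here (sym σu≡σw)))) ,
        (λ G G⊆ → on-edge G⊆ , edge-face) ,
        closed
        where
        OnEdge : List V → Set
        OnEdge G = G ⊆ (u ∷ w ∷ []) ⊎ G ⊆ (w ∷ σ u ∷ []) ⊎ G ⊆ (σ u ∷ σ w ∷ []) ⊎ G ⊆ (σ w ∷ u ∷ [])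

        drop₂ : ∀ {G a b c e} → G ⊆ (a ∷ b ∷ c ∷ e ∷ []) → a ∉ G → b ∉ G → G ⊆ (c ∷ e ∷ [])
        drop₂ G⊆ a∉ b∉ = ⊆∷∧∉⇒⊆ (⊆∷∧∉⇒⊆ G⊆ a∉) b∉

        on-edge : ∀ {G} → G ⊆ (u ∷ w ∷ σ u ∷ σ w ∷ []) → Δ G → OnEdge G
        on-edge G⊆ ΔG with antipode-absent u ΔG | antipode-absent w ΔG
        ... | inj₁ u∉  | inj₁ w∉  = inj₂ (inj₂ (inj₁ (drop₂ G⊆ u∉ w∉)))
        ... | inj₁ u∉  | inj₂ σw∉ = inj₂ (inj₁ (drop₂ (⊆-trans G⊆ rotate³⊆) σw∉ u∉))
        ... | inj₂ σu∉ | inj₁ w∉  = inj₂ (inj₂ (inj₂ (drop₂ (⊆-trans G⊆ rotate⊆) w∉ σu∉)))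
        ... | inj₂ σu∉ | inj₂ σw∉ = inj₁ (drop₂ (⊆-trans G⊆ rotate²⊆) σu∉ σw∉)

        edge-face : ∀ {G} → OnEdge G → Δ G
        edge-face (inj₁ G⊆)                 = downward _ _ G⊆ uw
        edge-face (inj₂ (inj₁ G⊆))          = downward _ _ G⊆ wσu
        edge-face (inj₂ (inj₂ (inj₁ G⊆)))   = downward _ _ G⊆ σuσw
        edge-face (inj₂ (inj₂ (inj₂ G⊆)))   = downward _ _ G⊆ σwu

        closed : ∀ x y → x ∈ (u ∷ w ∷ σ u ∷ σ w ∷ []) → y ≡ σ x → y ∈ (u ∷ w ∷ σ u ∷ σ w ∷ [])
        closed _ _ (here refl)                         refl = there (there (here refl))
        closed _ _ (there (here refl))                 refl = there (there (there (here refl)))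
        closed _ _ (there (there (here refl)))         refl = here (invol u (edge-vertex uw))
        closed _ _ (there (there (there (here refl)))) refl = there (here (invol w (edge-vertex wσu)))
        closed _ _ (there (there (there (there ())))) _

      square⇒HasInducedCS4 :
        ∀ {u w x y} → Δ (u ∷ w ∷ []) → Δ (w ∷ x ∷ []) → Δ (x ∷ y ∷ []) → Δ (y ∷ u ∷ []) →
        σ u ∈ (u ∷ w ∷ x ∷ y ∷ []) → σ w ∈ (w ∷ x ∷ y ∷ u ∷ []) →
        HasInducedCS4 Δ (λ a b → b ≡ σ a)
      square⇒HasInducedCS4 uw wx xy yu σu∈ σw∈
        with refl ← antipode-opposite uw yu σu∈
        with refl ← antipode-opposite wx uw σw∈ = antipodal-square⇒HasInducedCS4 uw wx xy yu

ιA : Apex → Apex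
ιA vp = vm
ιA vm = vp
ιA wp = wm
ιA wm = wp

sgn : Apex → Bool
sgn vp = true
sgn vm = false
sgn wp = true
sgn wm = false

sgn-ιA : ∀ p → sgn p ≢ sgn (ιA p)
sgn-ιA vp ()
sgn-ιA vm ()
sgn-ιA wp ()
sgn-ιA wm ()

-- Apexes get the junk base 0.
base : PV → ℕ
base (inj₁ (u , _)) = u
base (inj₂ _)       = 0

module PhiConstruction
  (d : ℕ) (S : Complex ℕ) (σ : ℕ → ℕ) (isC : IsComplex S) (cs : IsCS S σ)
  (B D : Complex ℕ) (Or : ℕ → ℕ → Set)
  (B⊆S : SubC B S) (isB : IsComplex B)
  (B∩σB⊆∂B : SubC (B ∩ᶜ Img σ B) (Bd (d ∸ 1) B))
  (∂B-uncontracted : ∀ {u} → IsVertex (Bd (d ∸ 1) B) u → ¬ DDset σ D u)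
  where

  open IsComplex isC using (downward)
  open IsCS cs using (faces)

  σB ∂B : Complex ℕ
  σB = Img σ B
  ∂B = Bd (d ∸ 1) B

  Φ' Φ : Complex PV
  Φ' = Phi' d S σ B Or
  Φ  = Phi d S σ B D Or

  _↦_ : PV → PV → Set
  _↦_ = CRel (DDset σ D)

  σB⊆S : SubC σB S
  σB⊆S G (F , BF , G⊆ , _) = downward _ G G⊆ (faces F (B⊆S F BF))

  ∂B⊆S : SubC ∂B S
  ∂B⊆S F (G , BG , _ , _ , F⊆G , _) = downward G F F⊆G (B⊆S G BG)

  occurs-σB : ∀ {u} → Occurs σB u → IsVertex σB u
  occurs-σB (_ , (F₀ , BF₀ , F⊆ , _) , u∈) with ∈-map⁻ σ (F⊆ u∈)
  ... | y , y∈ , refl = (y ∷ []) , occurs⇒vertex isB (F₀ , BF₀ , y∈) , ⊆-refl , ⊆-refl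

  occurs-∂B : ∀ {u} → Occurs ∂B u → IsVertex ∂B u
  occurs-∂B (_ , ∂BF , u∈) = Bd-downward (∈-∷⁺ʳ u∈ (λ ())) ∂BF

  -- The half of S beneath each apex: K₊ and L₋ lie over B, K₋ and L₊ over σ(B).
  Side : Apex → Complex ℕ
  Side vp = B
  Side vm = σB
  Side wp = σB
  Side wm = B

  sides-meet-in-∂B : ∀ p {u} → Occurs (Side p) u → Occurs (Side (ιA p)) u → IsVertex ∂B u
  sides-meet-in-∂B vp oB oσB = B∩σB⊆∂B _ (occurs⇒vertex isB oB , occurs-σB oσB)
  sides-meet-in-∂B vm oσB oB = B∩σB⊆∂B _ (occurs⇒vertex isB oB , occurs-σB oσB)
  sides-meet-in-∂B wp oσB oB = B∩σB⊆∂B _ (occurs⇒vertex isB oB , occurs-σB oσB)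
  sides-meet-in-∂B wm oB oσB = B∩σB⊆∂B _ (occurs⇒vertex isB oB , occurs-σB oσB)

  -- Where a vertex sharing a face of Φ' with the apex p can lie.
  Near : Apex → ℕ × Bool → Set
  Near p (u , t) = t ≡ sgn p × (Occurs (Side p) u ⊎ Occurs ∂B u)

  near-antipodes⇒∂B : ∀ p {u t t'} → Near p (u , t) → Near (ιA p) (u , t') → IsVertex ∂B u
  near-antipodes⇒∂B p (_ , inj₂ o)  _            = occurs-∂B o
  near-antipodes⇒∂B p (_ , inj₁ _)  (_ , inj₂ o) = occurs-∂B o
  near-antipodes⇒∂B p (_ , inj₁ o)  (_ , inj₁ o') = sides-meet-in-∂B p o o'

  -- The constraint that a common face of Φ' puts on two of its vertices.
  Compatible : PV → PV → Set
  Compatible (inj₁ (u , _)) (inj₁ (w , _)) = S (u ∷ w ∷ [])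
  Compatible (inj₁ (u , t)) (inj₂ p)       = Near p (u , t)
  Compatible (inj₂ p)       (inj₁ (u , t)) = Near p (u , t)
  Compatible (inj₂ p)       (inj₂ q)       = sgn p ≡ sgn q

  FaceCompatible : List PV → Set
  FaceCompatible F = ∀ {x y} → x ∈ F → y ∈ F → Compatible x y

  ApexCompatible : Apex → List PV → Set
  ApexCompatible a F = ∀ {x} → x ∈ F → Compatible (inj₂ a) x

  compatible-flip : ∀ {a} x → Compatible (inj₂ a) x → Compatible x (inj₂ a)
  compatible-flip (inj₁ _) near  = near
  compatible-flip (inj₂ _) sgn≡ = sym sgn≡

  Img-lift-compatible : ∀ {t X H} → SubC X S → Img (lift t) X H → FaceCompatible H
  Img-lift-compatible {t} X⊆S (F , XF , H⊆ , _) x∈ y∈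
    with ∈-map⁻ (lift t) (H⊆ x∈) | ∈-map⁻ (lift t) (H⊆ y∈)
  ... | _ , u∈ , refl | _ , w∈ , refl = face-edge isC (X⊆S F XF) u∈ w∈

  Img-lift-apexCompatible : ∀ {t a X H} → t ≡ sgn a →
                            (∀ {u} → Occurs X u → Occurs (Side a) u ⊎ Occurs ∂B u) →
                            Img (lift t) X H → ApexCompatible a H
  Img-lift-apexCompatible {t} t≡ near (F , XF , H⊆ , _) x∈ with ∈-map⁻ (lift t) (H⊆ x∈)
  ... | _ , u∈ , refl = t≡ , near (F , XF , u∈)

  Sigma-compatible : ∀ {H} → Img inj₁ (Sigma S Or) H → FaceCompatible H
  Sigma-compatible (G , (SG , _) , H⊆ , _) x∈ y∈
    with ∈-map⁻ inj₁ (H⊆ x∈) | ∈-map⁻ inj₁ (H⊆ y∈)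
  ... | _ , z∈ , refl | _ , z'∈ , refl = face-edge isC SG (∈-map⁺ proj₁ z∈) (∈-map⁺ proj₁ z'∈)

  cone-compatible : ∀ {a K F} → (∀ {H} → K H → FaceCompatible H) →
                    (∀ {H} → K H → ApexCompatible a H) → Cone (inj₂ a) K F → FaceCompatible F
  cone-compatible K-comp _ (inj₁ k) = K-comp k
  cone-compatible {a} K-comp K-apex (inj₂ (_ , k , F⊆ , _)) {x} x∈ y∈ with F⊆ x∈ | F⊆ y∈
  ... | here refl  | here refl  = refl
  ... | here refl  | there y∈H  = K-apex k y∈H
  ... | there x∈H  | here refl  = compatible-flip {a} x (K-apex k x∈H)
  ... | there x∈H  | there y∈H  = K-comp k x∈H y∈H

  cone-apexCompatible : ∀ {a b K F} → Compatible (inj₂ b) (inj₂ a) →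
                        (∀ {H} → K H → ApexCompatible b H) → Cone (inj₂ a) K F → ApexCompatible b F
  cone-apexCompatible _ K-apex (inj₁ k) = K-apex k
  cone-apexCompatible ba K-apex (inj₂ (_ , k , F⊆ , _)) x∈ with F⊆ x∈
  ... | here refl = ba
  ... | there x∈H = K-apex k x∈H

  -- The links L₊ = L vp σB and L₋ = L vm B of the apexes w₊ and w₋.
  L : Apex → Complex ℕ → Complex PV
  L a X = Img (lift (sgn a)) X ∪ᶜ Cone (inj₂ a) (Img (lift (sgn a)) ∂B)

  L-compatible : ∀ {a X F} → SubC X S → L a X F → FaceCompatible F
  L-compatible X⊆S (inj₁ i) = Img-lift-compatible X⊆S i
  L-compatible _   (inj₂ c) =
    cone-compatible (Img-lift-compatible ∂B⊆S) (Img-lift-apexCompatible refl inj₂) c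

  L-apexCompatible : ∀ {a b X F} → sgn a ≡ sgn b → (∀ {u} → Occurs X u → Occurs (Side b) u) →
                     L a X F → ApexCompatible b F
  L-apexCompatible a≡b onSide (inj₁ i) = Img-lift-apexCompatible a≡b (λ o → inj₁ (onSide o)) i
  L-apexCompatible a≡b _      (inj₂ c) =
    cone-apexCompatible (sym a≡b) (Img-lift-apexCompatible a≡b inj₂) c

  Φ'-compatible : ∀ {F} → Φ' F → FaceCompatible F
  Φ'-compatible (inj₁ s) = Sigma-compatible s
  Φ'-compatible (inj₂ (inj₁ c)) =
    cone-compatible (Img-lift-compatible B⊆S) (Img-lift-apexCompatible refl inj₁) c
  Φ'-compatible (inj₂ (inj₂ (inj₁ c))) =
    cone-compatible (Img-lift-compatible σB⊆S) (Img-lift-apexCompatible refl inj₁) c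
  Φ'-compatible (inj₂ (inj₂ (inj₂ (inj₁ c)))) =
    cone-compatible (L-compatible σB⊆S) (L-apexCompatible refl (λ o → o)) c
  Φ'-compatible (inj₂ (inj₂ (inj₂ (inj₂ c)))) =
    cone-compatible (L-compatible B⊆S) (L-apexCompatible refl (λ o → o)) c

  ↦-apex : ∀ {x p} → x ↦ inj₂ p → x ≡ inj₂ p
  ↦-apex {inj₁ (_ , false)} (inj₁ (_ , ()))
  ↦-apex {inj₁ (_ , false)} (inj₂ (_ , ()))
  ↦-apex {inj₁ (_ , true)}  ()
  ↦-apex {inj₂ _}           refl = refl

  ↦-lift : ∀ {x u t} → x ↦ inj₁ (u , t) → ∃[ t₀ ] (x ≡ inj₁ (u , t₀))
  ↦-lift {inj₁ (_ , false)} (inj₁ (_ , refl)) = false , refl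
  ↦-lift {inj₁ (_ , false)} (inj₂ (_ , refl)) = false , refl
  ↦-lift {inj₁ (_ , true)}  refl              = true , refl

  ↦-base : ∀ {x y} → x ↦ y → base y ≡ base x
  ↦-base {inj₁ (_ , false)} (inj₁ (_ , refl)) = refl
  ↦-base {inj₁ (_ , false)} (inj₂ (_ , refl)) = refl
  ↦-base {inj₁ (_ , true)}  refl              = refl
  ↦-base {inj₂ _}           refl              = refl

  -- Doubly negated because membership in V(D) ∪ V(σ D) is not decidable.
  ↦-total : ∀ x → ¬ ¬ (∃[ y ] (x ↦ y))
  ↦-total (inj₁ (_ , true))  k = k (_ , refl)
  ↦-total (inj₁ (_ , false)) k = k (_ , inj₂ ((λ c → k (_ , inj₁ (c , refl))) , refl))
  ↦-total (inj₂ _)           k = k (_ , refl)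

  ↦-collision : ∀ {u t₀ t₁ y} → t₀ ≢ t₁ → lift t₀ u ↦ y → lift t₁ u ↦ y → DDset σ D u
  ↦-collision {t₀ = true}  {true}  t₀≢t₁ _ _ = ⊥-elim (t₀≢t₁ refl)
  ↦-collision {t₀ = true}  {false} _ refl (inj₁ (c , _)) = c
  ↦-collision {t₀ = true}  {false} _ refl (inj₂ (_ , ()))
  ↦-collision {t₀ = false} {true}  _ (inj₁ (c , _)) _ = c
  ↦-collision {t₀ = false} {true}  _ (inj₂ (_ , refl)) ()
  ↦-collision {t₀ = false} {false} t₀≢t₁ _ _ = ⊥-elim (t₀≢t₁ refl)

  Edge : PV → PV → Set
  Edge x y = Φ (x ∷ y ∷ [])

  edge-sym : ∀ {x y} → Edge x y → Edge y x
  edge-sym (F , φ , G' , pw , ⊆G' , G'⊆) = F , φ , G' , pw , ⊆-trans swap⊆ ⊆G' , ⊆-trans G'⊆ swap⊆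

  edge-preimage : ∀ {x y} → Edge x y → ∃[ x₀ ] ∃[ y₀ ] (x₀ ↦ x × y₀ ↦ y × Compatible x₀ y₀)
  edge-preimage (_ , φ , _ , pw , ⊆G' , _)
    with Pointwise-∈ʳ pw (⊆G' (here refl)) | Pointwise-∈ʳ pw (⊆G' (there (here refl)))
  ... | x₀ , x₀∈ , x₀↦ | y₀ , y₀∈ , y₀↦ = x₀ , y₀ , x₀↦ , y₀↦ , Φ'-compatible φ x₀∈ y₀∈

  apex-edge-sgn : ∀ {p q} → Edge (inj₂ p) (inj₂ q) → sgn p ≡ sgn q
  apex-edge-sgn e with edge-preimage e
  ... | _ , _ , p₀↦ , q₀↦ , comp with ↦-apex p₀↦ | ↦-apex q₀↦
  ...   | refl | refl = comp

  apex-lift-edge : ∀ {p u t} → Edge (inj₂ p) (inj₁ (u , t)) →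
                   ∃[ t₀ ] (lift t₀ u ↦ inj₁ (u , t) × Near p (u , t₀))
  apex-lift-edge e with edge-preimage e
  ... | _ , _ , p₀↦ , x₀↦ , comp with ↦-apex p₀↦ | ↦-lift x₀↦
  ...   | refl | t₀ , refl = t₀ , x₀↦ , comp

  lift-edge : ∀ {u t w s} → Edge (inj₁ (u , t)) (inj₁ (w , s)) → S (u ∷ w ∷ [])
  lift-edge e with edge-preimage e
  ... | _ , _ , x₀↦ , y₀↦ , comp with ↦-lift x₀↦ | ↦-lift y₀↦
  ...   | _ , refl | _ , refl = comp

  antipodal-apexes-nonadjacent : ∀ {p} → ¬ Edge (inj₂ p) (inj₂ (ιA p))
  antipodal-apexes-nonadjacent {p} e = sgn-ιA p (apex-edge-sgn e)

  antipodal-apexes-no-common-neighbour : ∀ {p} x → Edge (inj₂ p) x → ¬ Edge x (inj₂ (ιA p))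
  antipodal-apexes-no-common-neighbour {p} (inj₂ _) e e' =
    sgn-ιA p (trans (apex-edge-sgn e) (apex-edge-sgn e'))
  antipodal-apexes-no-common-neighbour {p} (inj₁ _) e e'
    with apex-lift-edge e | apex-lift-edge (edge-sym e')
  ... | _ , ↦₀ , near@(refl , _) | _ , ↦₁ , near'@(refl , _) =
    ∂B-uncontracted (near-antipodes⇒∂B p near near') (↦-collision (sgn-ιA p) ↦₀ ↦₁)

  invPhi-apex : ∀ p → InvPhi σ D (inj₂ p) (inj₂ (ιA p))
  invPhi-apex vp = inj₂ vp , refl , refl
  invPhi-apex vm = inj₂ vm , refl , refl
  invPhi-apex wp = inj₂ wp , refl , refl
  invPhi-apex wm = inj₂ wm , refl , refl

  antipode-exists : ∀ {x₀ u t} → x₀ ↦ inj₁ (u , t) →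
                    ¬ ¬ (∃[ y ] (InvPhi σ D (inj₁ (u , t)) y × base y ≡ σ u))
  antipode-exists x₀↦ k with ↦-lift x₀↦
  ... | _ , refl = ↦-total _ λ (y , ↦y) → k (y , (_ , x₀↦ , ↦y) , ↦-base ↦y)

  record CSSquare (a b c e : PV) : Set where
    field
      ab : Edge a b
      bc : Edge b c
      ce : Edge c e
      ea : Edge e a
      closed : ∀ x y → x ∈ (a ∷ b ∷ c ∷ e ∷ []) → InvPhi σ D x y → y ∈ (a ∷ b ∷ c ∷ e ∷ [])

  rotate : ∀ {a b c e} → CSSquare a b c e → CSSquare b c e a
  rotate sq = record
    { ab = bc ; bc = ce ; ce = ea ; ea = ab
    ; closed = λ x y x∈ inv → rotate⊆ (closed x y (rotate³⊆ x∈) inv)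
    }
    where open CSSquare sq

  apex-antipode-off-square : ∀ {p b c e} → Edge (inj₂ p) b → Edge b c → Edge e (inj₂ p) →
                             inj₂ (ιA p) ∉ (inj₂ p ∷ b ∷ c ∷ e ∷ [])
  apex-antipode-off-square {p} _ _ _ (here ιp≡p) = sgn-ιA p (cong sgn (sym (inj₂-injective ιp≡p)))
  apex-antipode-off-square pb _ _ (there (here refl)) = antipodal-apexes-nonadjacent pb
  apex-antipode-off-square {b = b} pb bc _ (there (there (here refl))) =
    antipodal-apexes-no-common-neighbour b pb bc
  apex-antipode-off-square _ _ ep (there (there (there (here refl)))) =
    antipodal-apexes-nonadjacent (edge-sym ep)
  apex-antipode-off-square _ _ _ (there (there (there (there ()))))

  square-apex : ∀ {p b c e} → ¬ CSSquare (inj₂ p) b c e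
  square-apex {p} sq = apex-antipode-off-square ab bc ea (closed _ _ (here refl) (invPhi-apex p))
    where open CSSquare sq

  square-antipode : ∀ {u t b c e} → CSSquare (inj₁ (u , t)) b c e →
                    ¬ ¬ (σ u ∈ map base (inj₁ (u , t) ∷ b ∷ c ∷ e ∷ []))
  square-antipode sq k with edge-preimage (CSSquare.ab sq)
  ... | _ , _ , x₀↦ , _ = antipode-exists x₀↦ λ (y , inv , y≡σu) →
    k (subst (_∈ _) y≡σu (∈-map⁺ base (CSSquare.closed sq _ y (here refl) inv)))

  square-lifts : ∀ {u t w s x r y q} → ¬ HasInducedCS4 S (λ a b → b ≡ σ a) →
                 ¬ CSSquare (inj₁ (u , t)) (inj₁ (w , s)) (inj₁ (x , r)) (inj₁ (y , q))
  square-lifts noCS4 sq =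
    square-antipode sq λ σu∈ →
    square-antipode (rotate sq) λ σw∈ →
    noCS4 (square⇒HasInducedCS4 isC cs _≟_
             (lift-edge ab) (lift-edge bc) (lift-edge ce) (lift-edge ea) σu∈ σw∈)
    where open CSSquare sq

  no-CSSquare : ¬ HasInducedCS4 S (λ x y → y ≡ σ x) → ∀ {a b c e} → ¬ CSSquare a b c e
  no-CSSquare _ {inj₂ _} sq = square-apex sq
  no-CSSquare _ {inj₁ _} {inj₂ _} sq = square-apex (rotate sq)
  no-CSSquare _ {inj₁ _} {inj₁ _} {inj₂ _} sq = square-apex (rotate (rotate sq))
  no-CSSquare _ {inj₁ _} {inj₁ _} {inj₁ _} {inj₂ _} sq = square-apex (rotate (rotate (rotate sq)))
  no-CSSquare noCS4 {inj₁ _} {inj₁ _} {inj₁ _} {inj₁ _} sq = square-lifts noCS4 sq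

  no-induced-CS4 : ¬ HasInducedCS4 S (λ x y → y ≡ σ x) → ¬ HasInducedCS4 Φ (InvPhi σ D)
  no-induced-CS4 noCS4 (_ , _ , _ , _ , _ , _ , _ , _ , _ , _ , induced , closed) =
    no-CSSquare noCS4 (record
      { ab = proj₂ (induced _ (pair⊆ (here refl) (there (here refl)))) (inj₁ ⊆-refl)
      ; bc = proj₂ (induced _ (pair⊆ (there (here refl)) (there (there (here refl)))))
                   (inj₂ (inj₁ ⊆-refl))
      ; ce = proj₂ (induced _ (pair⊆ (there (there (here refl))) (there (there (there (here refl))))))
                   (inj₂ (inj₂ (inj₁ ⊆-refl)))
      ; ea = proj₂ (induced _ (pair⊆ (there (there (there (here refl)))) (here refl)))
                   (inj₂ (inj₂ (inj₂ ⊆-refl)))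
      ; closed = closed
      })

boundary-uncontracted : ∀ {i σ Si Sprev B D v u} → PLevel i σ Si Sprev B D v →
                        IsVertex (Bd i B) u → ¬ DDset σ D u
boundary-uncontracted {u = u} lv ∂Bu dd with proj₂ (PLevel.diffD lv (u ∷ [])) dd
... | _ , (u∉Sprev ∷ _) = u∉Sprev (proj₁ (PLevel.bdB lv (u ∷ [])) ∂Bu)

proposition4p3 : (d : ℕ) → 2 ≤ d →
    (S : Complex ℕ) (σ : ℕ → ℕ) → IsComplex S → IsCS S σ →
    (Sf Bf Df : ℕ → Complex ℕ) (vf : ℕ → ℕ) →
    PropP (d ∸ 1) S σ Sf Bf Df vf →
    (Or : ℕ → ℕ → Set) → IsLocAcyclicOrientation S Or →
    (∀ u w → InW (Df (d ∸ 1)) (Sf (d ∸ 2)) (vf (d ∸ 2)) u →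
       (∃[ x ] (InW (Df (d ∸ 1)) (Sf (d ∸ 2)) (vf (d ∸ 2)) x × w ≡ σ x)) →
       S (u ∷ w ∷ []) → Or u w) →
    (∀ u w → (Or u w → Or (σ w) (σ u)) × (Or (σ w) (σ u) → Or u w)) →
    ¬ HasInducedCS4 S (λ x y → y ≡ σ x) →
    ¬ HasInducedCS4 (Phi d S σ (Bf (d ∸ 1)) (Df (d ∸ 1)) Or) (InvPhi σ (Df (d ∸ 1)))
proposition4p3 d@(suc (suc k)) (s≤s (s≤s z≤n)) S σ isC cs Sf Bf Df vf P Or _ _ _ =
  PhiConstruction.no-induced-CS4 d S σ isC cs (Bf (suc k)) (Df (suc k)) Or
    (λ F BF → PropP.subS P (suc k) ≤-refl F (PLevel.subB topLevel F BF))
    (proj₁ (PLevel.ballB topLevel))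
    (λ F → proj₁ (PLevel.interB topLevel F))
    (boundary-uncontracted topLevel)
  where
  topLevel = PropP.level P k ≤-refl
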